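{- Let $n\ge 1$ and let $1\le i_1<i_2<\cdots<i_k\le n-1$ be row indices. Then \[ \eta_n(i_1,i_2,\ldots,i_k)=A(i_1)A(i_2-i_1)\cdots A(i_k-i_{k-1})A(n-i_k). \]
   Context: A monotone triangle of size $n$ is a triangular array of integers $\tau=(\tau(i,j))_{1\le j\le i\le n}$, with $i$ entries in row $i$, entries in $[n]$, such that $\tau(i,j)<\tau(i,j+1)$ and $\tau(i,j)\le\tau(i-1,j)\le\tau(i,j+1)$ for $1\le j<i$. $\mathfrak{M}_n$ is the set of these and $A(n)=|\mathfrak{M}_n|$, with $A(0)=1$. Row $i_0$ of $\tau$ is called distinguished if $\tau(i_0,j)=j$ for all $1\le j\le i_0$; $\mathcal{D}(\tau)$ denotes the set of distinguished rows of $\tau$ (row $n$ is always distinguished). For $\mathcal{I}=\{i_1,\ldots,i_k\}\subseteq[n-1]$, $\eta_n(\mathcal{I})=\eta_n(i_1,\ldots,i_k)$ is the number of $\tau\in\mathfrak{M}_n$ with $\mathcal{I}\cup\{n\}\subseteq\mathcal{D}(\tau)$. -}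

module Defs where

open import Data.Nat using (ℕ; zero; suc; _*_; _∸_; _≤ᵇ_; _<ᵇ_; _≡ᵇ_)
open import Data.Bool using (Bool; true; false; _∧_; if_then_else_; T)
open import Data.Unit using (⊤; tt)
open import Data.Product using (Σ; _×_; _,_)
open import Data.Vec using (Vec; []; _∷_)
open import Data.List using (List; []; _∷_)
open import Data.List.Relation.Unary.All using (All)

-- A triangular array with m rows: row i (1 ≤ i ≤ m) is a vector of length i.
-- Tri (suc m) = (first m rows , row m+1).
Tri : ℕ → Set
Tri zero    = ⊤
Tri (suc m) = Tri m × Vec ℕ (suc m)

inRange : ∀ {k} → ℕ → Vec ℕ k → Bool
inRange n []       = true
inRange n (x ∷ xs) = (1 ≤ᵇ x) ∧ (x ≤ᵇ n) ∧ inRange n xs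

strict : ∀ {k} → Vec ℕ k → Bool
strict []           = true
strict (x ∷ [])     = true
strict (x ∷ y ∷ ys) = (x <ᵇ y) ∧ strict (y ∷ ys)

interlace : ∀ {k} → Vec ℕ k → Vec ℕ (suc k) → Bool
interlace []       (x ∷ [])     = true
interlace (p ∷ ps) (x ∷ y ∷ rs) = (x ≤ᵇ p) ∧ (p ≤ᵇ y) ∧ interlace ps (y ∷ rs)

interlaceLast : ∀ m → Tri m → Vec ℕ (suc m) → Bool
interlaceLast zero    tt      r = true
interlaceLast (suc m) (t , p) r = interlace p r

validRows : (n : ℕ) → ∀ m → Tri m → Bool
validRows n zero    tt      = true
validRows n (suc m) (t , r) =
  validRows n m t ∧ inRange n r ∧ strict r ∧ interlaceLast m t r

IsMT : (n : ℕ) → Tri n → Bool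
IsMT n = validRows n n

MT : ℕ → Set
MT n = Σ (Tri n) (λ τ → T (IsMT n τ))

isIdRow : ∀ {k} → ℕ → Vec ℕ k → Bool
isIdRow s []       = true
isIdRow s (x ∷ xs) = (x ≡ᵇ s) ∧ isIdRow (suc s) xs

-- row i of τ (with 1 ≤ i ≤ m) satisfies τ(i,j) = j for all j; false if i not a row
distinguished : ∀ m → ℕ → Tri m → Bool
distinguished zero    i tt      = false
distinguished (suc m) i (t , r) =
  if i ≡ᵇ suc m then isIdRow 1 r else distinguished m i t

-- monotone triangles of size n with I ∪ {n} ⊆ 𝒟(τ); its cardinality is η_n(I)
EtaSet : (n : ℕ) → List ℕ → Set
EtaSet n I = Σ (MT n) (λ τ → All (λ i → T (distinguished n i (Σ.proj₁ τ))) (n ∷ I))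

-- A(i₁) A(i₂ - i₁) ⋯ A(i_k - i_{k-1}) A(n - i_k), with prev the previous index (start 0)
gapProduct : (ℕ → ℕ) → ℕ → List ℕ → ℕ → ℕ
gapProduct A prev []       n = A (n ∸ prev)
gapProduct A prev (i ∷ is) n = A (i ∸ prev) * gapProduct A i is n

module Submission where

-- Let τ be a monotone triangle of size m + s whose row s is
-- 1,…,s.  By interlacing and strictness every later row again starts with
-- 1,…,s and continues with entries above s.  So τ is glued from a triangle a
-- of size s ending in the row 1,…,s, and a triangle b of size m (the later
-- rows with the prefix removed and s subtracted); a and b are again monotone
-- triangles, and row j + s of τ is distinguished exactly when row j of b is.
-- Conversely every such pair glues to such a τ (Gluing.glue↔).  Moreover the
-- last row of a monotone triangle of size n ≥ 1 is always 1,…,n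
-- (monotone-last-distinguished), so η_n() = A(n).  Cutting at the first
-- distinguished row and recursing on the rest gives the product formula
-- (Counting.gaps↔), from which lemma3 follows.
--
-- Triangles are glued at size m + s (not s + m) so that the
-- recursion on m needs no casts on triangles, only on single rows.

open import Defs
open import Data.Nat using (ℕ; zero; suc; _+_; _*_; _∸_; _≤_; _<_; z≤n; s≤s; z<s; _≤ᵇ_; _<ᵇ_; _≡ᵇ_)
open import Data.Nat.Properties
open import Data.Bool using (Bool; true; false; _∧_; if_then_else_; T)
open import Data.Bool.Properties using (T-irrelevant; T-≡; T-∧; ∧-zeroʳ; ∧-identityʳ; ∧-assoc)
open import Data.Unit using (tt)
open import Data.Empty using (⊥-elim)
open import Data.Product using (∃; _×_; _,_; proj₁; proj₂)
open import Data.Vec as V using (Vec; []; _∷_; toList)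
import Data.Vec.Properties as VP
open import Data.List as L using (List; []; _∷_; _++_)
import Data.List.Properties as LP
open import Data.List.Relation.Unary.All as All using (All; []; _∷_)
import Data.List.Relation.Unary.All.Properties as AllP
open import Data.List.Relation.Unary.AllPairs using (AllPairs; []; _∷_)
open import Data.List.Relation.Unary.Linked using (Linked)
open import Data.List.Relation.Unary.Linked.Properties using (Linked⇒AllPairs)
open import Data.Fin using (Fin)
open import Data.Fin.Properties using (*↔×)
open import Data.Product.Function.NonDependent.Propositional using (_×-↔_)
open import Function.Bundles using (_↔_; mk↔ₛ′; Equivalence)
open import Function.Properties.Inverse using (↔-sym; ↔-trans)
open import Function using (_∘_)
open import Relation.Binary.PropositionalEquality

∧-intro : ∀ {a b} → T a → T b → T (a ∧ b)
∧-intro p q = Equivalence.from T-∧ (p , q)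

∧-elim : ∀ a {b} → T (a ∧ b) → T a × T b
∧-elim a = Equivalence.to T-∧

T-ext : ∀ {a b} → (T a → T b) → (T b → T a) → a ≡ b
T-ext {true}  {true}  _ _ = refl
T-ext {true}  {false} f _ = ⊥-elim (f tt)
T-ext {false} {true}  _ g = ⊥-elim (g tt)
T-ext {false} {false} _ _ = refl

∧-cong-under : ∀ {a b} c → (T c → a ≡ b) → a ∧ c ≡ b ∧ c
∧-cong-under {a} {b} false _  = trans (∧-zeroʳ a) (sym (∧-zeroʳ b))
∧-cong-under {a} {b} true  eq = trans (∧-identityʳ a) (trans (eq tt) (sym (∧-identityʳ b)))

∧-regroup : ∀ a b c d c′ d′ e → c ∧ d ≡ c′ ∧ d′ → (a ∧ b) ∧ c ∧ d ∧ e ≡ a ∧ b ∧ c′ ∧ d′ ∧ e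
∧-regroup a b c d c′ d′ e cd≡c′d′ = begin
  (a ∧ b) ∧ c ∧ d ∧ e     ≡⟨ ∧-assoc a b _ ⟩
  a ∧ b ∧ c ∧ d ∧ e       ≡⟨ cong (λ x → a ∧ b ∧ x) (∧-assoc c d e) ⟨
  a ∧ b ∧ (c ∧ d) ∧ e     ≡⟨ cong (λ x → a ∧ b ∧ x ∧ e) cd≡c′d′ ⟩
  a ∧ b ∧ (c′ ∧ d′) ∧ e   ≡⟨ cong (λ x → a ∧ b ∧ x) (∧-assoc c′ d′ e) ⟩
  a ∧ b ∧ c′ ∧ d′ ∧ e     ∎
  where open ≡-Reasoning

T⇒true : ∀ {b} → T b → b ≡ true
T⇒true = Equivalence.to T-≡

≢⇒≡ᵇ-false : ∀ {m n} → m ≢ n → (m ≡ᵇ n) ≡ false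
≢⇒≡ᵇ-false {m} {n} m≢n = T-ext (λ t → m≢n (≡ᵇ⇒≡ m n t)) (λ ())

≡ᵇ-+ʳ : ∀ d a b → ((a + d) ≡ᵇ (b + d)) ≡ (a ≡ᵇ b)
≡ᵇ-+ʳ d a b = T-ext (λ t → ≡⇒≡ᵇ a b (+-cancelʳ-≡ d a b (≡ᵇ⇒≡ _ _ t)))
                    (λ t → ≡⇒≡ᵇ _ _ (cong (_+ d) (≡ᵇ⇒≡ a b t)))

<ᵇ-+ʳ : ∀ d a b → ((a + d) <ᵇ (b + d)) ≡ (a <ᵇ b)
<ᵇ-+ʳ d a b = T-ext (λ t → <⇒<ᵇ (+-cancelʳ-< d a b (<ᵇ⇒< _ _ t)))
                    (λ t → <⇒<ᵇ (+-monoˡ-< d (<ᵇ⇒< a b t)))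

≤ᵇ-+ʳ : ∀ d a b → ((a + d) ≤ᵇ (b + d)) ≡ (a ≤ᵇ b)
≤ᵇ-+ʳ d a b = T-ext (λ t → ≤⇒≤ᵇ (+-cancelʳ-≤ d a b (≤ᵇ⇒≤ _ _ t)))
                    (λ t → ≤⇒≤ᵇ (+-monoˡ-≤ d (≤ᵇ⇒≤ a b t)))

-- The row tests of Defs, restated on lists so that rows of different
-- lengths (a row and its glued copy, a row and the previous row) can be
-- compared without length casts.

inRangeL : ℕ → List ℕ → Bool
inRangeL n []       = true
inRangeL n (x ∷ xs) = (1 ≤ᵇ x) ∧ (x ≤ᵇ n) ∧ inRangeL n xs

strictL : List ℕ → Bool
strictL []           = true
strictL (x ∷ [])     = true
strictL (x ∷ y ∷ ys) = (x <ᵇ y) ∧ strictL (y ∷ ys)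

interlaceL : List ℕ → List ℕ → Bool
interlaceL []       (x ∷ [])     = true
interlaceL (p ∷ ps) (x ∷ y ∷ rs) = (x ≤ᵇ p) ∧ (p ≤ᵇ y) ∧ interlaceL ps (y ∷ rs)
interlaceL _        _            = false

isIdRowL : ℕ → List ℕ → Bool
isIdRowL c []       = true
isIdRowL c (x ∷ xs) = (x ≡ᵇ c) ∧ isIdRowL (suc c) xs

inRange-toList : ∀ n {k} (v : Vec ℕ k) → inRange n v ≡ inRangeL n (toList v)
inRange-toList n []      = refl
inRange-toList n (x ∷ v) = cong (λ b → (1 ≤ᵇ x) ∧ (x ≤ᵇ n) ∧ b) (inRange-toList n v)

strict-toList : ∀ {k} (v : Vec ℕ k) → strict v ≡ strictL (toList v)
strict-toList []          = refl
strict-toList (x ∷ [])    = refl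
strict-toList (x ∷ y ∷ v) = cong ((x <ᵇ y) ∧_) (strict-toList (y ∷ v))

interlace-toList : ∀ {k} (p : Vec ℕ k) (r : Vec ℕ (suc k)) →
                   interlace p r ≡ interlaceL (toList p) (toList r)
interlace-toList []       (x ∷ [])     = refl
interlace-toList (p ∷ ps) (x ∷ y ∷ rs) =
  cong (λ b → (x ≤ᵇ p) ∧ (p ≤ᵇ y) ∧ b) (interlace-toList ps (y ∷ rs))

isIdRow-toList : ∀ c {k} (v : Vec ℕ k) → isIdRow c v ≡ isIdRowL c (toList v)
isIdRow-toList c []      = refl
isIdRow-toList c (x ∷ v) = cong ((x ≡ᵇ c) ∧_) (isIdRow-toList (suc c) v)

InRange : ℕ → ℕ → Set
InRange n x = 1 ≤ x × x ≤ n

inRangeL⇒All : ∀ n xs → T (inRangeL n xs) → All (InRange n) xs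
inRangeL⇒All n []       _ = []
inRangeL⇒All n (x ∷ xs) t
  with ∧-elim (1 ≤ᵇ x) t
... | lo , t′ with ∧-elim (x ≤ᵇ n) t′
...   | hi , t″ = (≤ᵇ⇒≤ 1 x lo , ≤ᵇ⇒≤ x n hi) ∷ inRangeL⇒All n xs t″

All⇒inRangeL : ∀ n xs → All (InRange n) xs → T (inRangeL n xs)
All⇒inRangeL n []       []                 = tt
All⇒inRangeL n (x ∷ xs) ((lo , hi) ∷ rest) =
  ∧-intro (≤⇒≤ᵇ lo) (∧-intro (≤⇒≤ᵇ hi) (All⇒inRangeL n xs rest))

strictL-tail : ∀ x xs → T (strictL (x ∷ xs)) → T (strictL xs)
strictL-tail x []       _ = tt
strictL-tail x (y ∷ ys) t = proj₂ (∧-elim (x <ᵇ y) t)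

strictL-head : ∀ x xs → T (strictL (x ∷ xs)) → All (x <_) xs
strictL-head x []       _ = []
strictL-head x (y ∷ ys) t with ∧-elim (x <ᵇ y) t
... | x<y , t′ = x<y′ ∷ All.map (<-trans x<y′) (strictL-head y ys t′)
  where x<y′ = <ᵇ⇒< x y x<y

strictL-shift : ∀ d xs → strictL (L.map (_+ d) xs) ≡ strictL xs
strictL-shift d []           = refl
strictL-shift d (x ∷ [])     = refl
strictL-shift d (x ∷ y ∷ xs) = cong₂ _∧_ (<ᵇ-+ʳ d x y) (strictL-shift d (y ∷ xs))

interlaceL-shift : ∀ d ps rs → interlaceL (L.map (_+ d) ps) (L.map (_+ d) rs) ≡ interlaceL ps rs
interlaceL-shift d []       []           = refl
interlaceL-shift d []       (x ∷ [])     = refl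
interlaceL-shift d []       (x ∷ y ∷ rs) = refl
interlaceL-shift d (p ∷ ps) []           = refl
interlaceL-shift d (p ∷ ps) (x ∷ [])     = refl
interlaceL-shift d (p ∷ ps) (x ∷ y ∷ rs) =
  cong₂ _∧_ (≤ᵇ-+ʳ d x p) (cong₂ _∧_ (≤ᵇ-+ʳ d p y) (interlaceL-shift d ps (y ∷ rs)))

isIdRowL-shift : ∀ d c xs → isIdRowL (c + d) (L.map (_+ d) xs) ≡ isIdRowL c xs
isIdRowL-shift d c []       = refl
isIdRowL-shift d c (x ∷ xs) = cong₂ _∧_ (≡ᵇ-+ʳ d x c) (isIdRowL-shift d (suc c) xs)

run : ℕ → (k : ℕ) → Vec ℕ k
run c zero    = []
run c (suc k) = c ∷ run (suc c) k

runL : ℕ → ℕ → List ℕ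
runL c k = toList (run c k)

runL-bounds : ∀ c k → All (λ x → c ≤ x × x < c + k) (runL c k)
runL-bounds c zero    = []
runL-bounds c (suc k) =
  (≤-refl , m<m+n c z<s) ∷
  All.map (λ {x} (lo , hi) → ≤-trans (n≤1+n c) lo , subst (x <_) (sym (+-suc c k)) hi)
          (runL-bounds (suc c) k)

drop-run++ : ∀ c k ys → L.drop k (runL c k ++ ys) ≡ ys
drop-run++ c zero    ys = refl
drop-run++ c (suc k) ys = drop-run++ (suc c) k ys

isIdRowL⇒run : ∀ c xs → T (isIdRowL c xs) → xs ≡ runL c (L.length xs)
isIdRowL⇒run c []       _ = refl
isIdRowL⇒run c (x ∷ xs) t with ∧-elim (x ≡ᵇ c) t
... | x≡c , t′ = cong₂ _∷_ (≡ᵇ⇒≡ x c x≡c) (isIdRowL⇒run (suc c) xs t′)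

strict-bounded⇒run : ∀ c xs → T (strictL xs) → All (c ≤_) xs →
                     All (_< c + L.length xs) xs → T (isIdRowL c xs)
strict-bounded⇒run c []       _  _           _           = tt
strict-bounded⇒run c (x ∷ xs) st (c≤x ∷ _) (x<top ∷ up) =
  ∧-intro (≡⇒≡ᵇ x c (≤-antisym (head≤c xs st tailRun x<top) c≤x)) tailRun
  where
  tailRun : T (isIdRowL (suc c) xs)
  tailRun = strict-bounded⇒run (suc c) xs (strictL-tail x xs st)
              (All.map (≤-trans (s≤s c≤x)) (strictL-head x xs st))
              (All.map (λ {z} → subst (z <_) (+-suc c _)) up)
  -- x is below the next entry, which is c + 1; if x is last, x < c + 1 is given
  head≤c : ∀ ys → T (strictL (x ∷ ys)) → T (isIdRowL (suc c) ys) →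
           x < c + L.length (x ∷ ys) → x ≤ c
  head≤c []       _  _  x<c+1 = ≤-pred (subst (x <_) (+-comm c 1) x<c+1)
  head≤c (y ∷ ys) st ys-run _ =
    ≤-pred (subst (x <_) (≡ᵇ⇒≡ y (suc c) (proj₁ (∧-elim (y ≡ᵇ suc c) ys-run)))
                  (<ᵇ⇒< x y (proj₁ (∧-elim (x <ᵇ y) st))))

isIdRowL-run++ : ∀ c k xs → isIdRowL c (runL c k ++ xs) ≡ isIdRowL (k + c) xs
isIdRowL-run++ c zero    xs = refl
isIdRowL-run++ c (suc k) xs rewrite T⇒true (≡⇒≡ᵇ c c refl) =
  trans (isIdRowL-run++ (suc c) k xs) (cong (λ e → isIdRowL e xs) (+-suc k c))

strictL-run++ : ∀ c k y ys → strictL (runL c (suc k) ++ y ∷ ys) ≡ (k + c <ᵇ y) ∧ strictL (y ∷ ys)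
strictL-run++ c zero    y ys = refl
strictL-run++ c (suc k) y ys rewrite T⇒true (<⇒<ᵇ (n<1+n c)) =
  trans (strictL-run++ (suc c) k y ys) (cong (λ e → (e <ᵇ y) ∧ strictL (y ∷ ys)) (+-suc k c))

interlaceL-run++ : ∀ c k ps y ys → k + c ≤ y →
                   interlaceL (runL c (suc k) ++ ps) (runL c (suc k) ++ y ∷ ys) ≡ interlaceL ps (y ∷ ys)
interlaceL-run++ c zero    ps y ys c≤y
  rewrite T⇒true (≤⇒≤ᵇ (≤-refl {c})) | T⇒true (≤⇒≤ᵇ c≤y) = refl
interlaceL-run++ c (suc k) ps y ys k+c<y
  rewrite T⇒true (≤⇒≤ᵇ (≤-refl {c})) | T⇒true (≤⇒≤ᵇ (n≤1+n c)) =
  interlaceL-run++ (suc c) k ps y ys (subst (_≤ y) (sym (+-suc k c)) k+c<y)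

-- Below a row that starts with a run, an interlacing strictly increasing row
-- starts with the same run: entry j is squeezed between c + j - 1 (from
-- above) and the strictly increasing lower bounds.
interlaceL-keeps-run : ∀ c k ps r → T (interlaceL (runL c k ++ ps) r) → T (strictL r) →
                       All (c ≤_) r → ∃ λ r′ → r ≡ runL c k ++ r′ × All (c + k ≤_) r′
interlaceL-keeps-run c zero    ps r           _  _  lo =
  r , refl , subst (λ e → All (e ≤_) r) (sym (+-identityʳ c)) lo
interlaceL-keeps-run c (suc k) ps (x ∷ y ∷ r) il st (c≤x ∷ _)
  with ∧-elim (x ≤ᵇ c) il
... | x≤c , il′
  with interlaceL-keeps-run (suc c) k ps (y ∷ r) (proj₂ (∧-elim (c ≤ᵇ y) il′)) (strictL-tail x (y ∷ r) st)
                            (All.map (≤-trans (s≤s c≤x)) (strictL-head x (y ∷ r) st))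
... | r′ , eq , r′-lo =
  r′ , cong₂ _∷_ (≤-antisym (≤ᵇ⇒≤ x c x≤c) c≤x) eq ,
  subst (λ e → All (e ≤_) r′) (sym (+-suc c k)) r′-lo

glueL : ℕ → List ℕ → List ℕ
glueL s xs = runL 1 s ++ L.map (_+ s) xs

unglueL : ℕ → List ℕ → List ℕ
unglueL s xs = L.map (_∸ s) (L.drop s xs)

unglueL-glueL : ∀ s xs → unglueL s (glueL s xs) ≡ xs
unglueL-glueL s xs = begin
  L.map (_∸ s) (L.drop s (runL 1 s ++ L.map (_+ s) xs))  ≡⟨ cong (L.map (_∸ s)) (drop-run++ 1 s _) ⟩
  L.map (_∸ s) (L.map (_+ s) xs)                         ≡⟨ LP.map-∘ xs ⟨
  L.map (λ x → x + s ∸ s) xs                             ≡⟨ LP.map-id-local (All.tabulate (λ {x} _ → m+n∸n≡m x s)) ⟩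
  xs                                                     ∎
  where open ≡-Reasoning

glueL-unglueL : ∀ s r′ → All (s ≤_) r′ → glueL s (unglueL s (runL 1 s ++ r′)) ≡ runL 1 s ++ r′
glueL-unglueL s r′ r′≥s = cong (runL 1 s ++_) (begin
  L.map (_+ s) (L.map (_∸ s) (L.drop s (runL 1 s ++ r′)))
    ≡⟨ cong (L.map (_+ s) ∘ L.map (_∸ s)) (drop-run++ 1 s r′) ⟩
  L.map (_+ s) (L.map (_∸ s) r′)                          ≡⟨ LP.map-∘ r′ ⟨
  L.map (λ x → x ∸ s + s) r′                              ≡⟨ LP.map-id-local (All.map m∸n+n≡m r′≥s) ⟩
  r′                                                      ∎)
  where open ≡-Reasoning

strictL-glue : ∀ k y ys → strictL (glueL (suc k) (y ∷ ys)) ≡ (1 ≤ᵇ y) ∧ strictL (y ∷ ys)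
strictL-glue k y ys = begin
  strictL (runL 1 s ++ L.map (_+ s) (y ∷ ys))            ≡⟨ strictL-run++ 1 k (y + s) (L.map (_+ s) ys) ⟩
  (k + 1 <ᵇ y + s) ∧ strictL (L.map (_+ s) (y ∷ ys))     ≡⟨ cong₂ _∧_ (trans (cong (_<ᵇ y + s) (+-comm k 1)) (<ᵇ-+ʳ s 0 y))
                                                                      (strictL-shift s (y ∷ ys)) ⟩
  (0 <ᵇ y) ∧ strictL (y ∷ ys)                            ∎
  where
  open ≡-Reasoning
  s = suc k

-- Gluing a nonempty row keeps it in range and strictly increasing, with the
-- bound raised by s; the lower bound 1 of the row is what keeps the glued
-- row strict at the seam.
inRange-strict-glue : ∀ k R y ys →
  inRangeL (R + suc k) (glueL (suc k) (y ∷ ys)) ∧ strictL (glueL (suc k) (y ∷ ys))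
    ≡ inRangeL R (y ∷ ys) ∧ strictL (y ∷ ys)
inRange-strict-glue k R y ys rewrite strictL-glue k y ys = T-ext glued⇒row row⇒glued
  where
  s  = suc k
  xs = y ∷ ys
  glued⇒row : T (inRangeL (R + s) (glueL s xs) ∧ (1 ≤ᵇ y) ∧ strictL xs) →
              T (inRangeL R xs ∧ strictL xs)
  glued⇒row t with ∧-elim (inRangeL (R + s) (glueL s xs)) t
  ... | inR , t′ with ∧-elim (1 ≤ᵇ y) t′
  ...   | 1≤y , st = ∧-intro (All⇒inRangeL R xs (All.zipWith (λ (lo , hi) → lo , hi) (lower , upper))) st
    where
    upper : All (_≤ R) xs
    upper = All.map (λ {x} (_ , hi) → +-cancelʳ-≤ s x R hi)
                    (AllP.map⁻ (AllP.++⁻ʳ (runL 1 s) (inRangeL⇒All (R + s) (glueL s xs) inR)))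
    lower : All (1 ≤_) xs
    lower = ≤ᵇ⇒≤ 1 y 1≤y ∷ All.map (λ y<z → ≤-trans (≤ᵇ⇒≤ 1 y 1≤y) (<⇒≤ y<z)) (strictL-head y ys st)
  row⇒glued : T (inRangeL R xs ∧ strictL xs) →
              T (inRangeL (R + s) (glueL s xs) ∧ (1 ≤ᵇ y) ∧ strictL xs)
  row⇒glued t with ∧-elim (inRangeL R xs) t
  ... | inR , st = ∧-intro (All⇒inRangeL (R + s) (glueL s xs) (AllP.++⁺ runPart shiftedPart))
                           (∧-intro (≤⇒≤ᵇ (proj₁ (All.head xs-in))) st)
    where
    xs-in = inRangeL⇒All R xs inR
    runPart : All (InRange (R + s)) (runL 1 s)
    runPart = All.map (λ (lo , hi) → lo , ≤-trans (≤-pred hi) (m≤n+m s R)) (runL-bounds 1 s)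
    shiftedPart : All (InRange (R + s)) (L.map (_+ s) xs)
    shiftedPart = AllP.map⁺ (All.map (λ {x} (_ , hi) → ≤-trans (s≤s z≤n) (m≤n+m s x) , +-monoˡ-≤ s hi)
                                     xs-in)

-- Glued rows interlace exactly when the original rows do: the common prefix
-- 1,…,s interlaces with itself, and its last entry s is below the seam.
interlaceL-glue : ∀ k ps y ys → interlaceL (glueL (suc k) ps) (glueL (suc k) (y ∷ ys)) ≡ interlaceL ps (y ∷ ys)
interlaceL-glue k ps y ys =
  trans (interlaceL-run++ 1 k (L.map (_+ suc k) ps) (y + suc k) (L.map (_+ suc k) ys)
                          (subst (_≤ y + suc k) (+-comm 1 k) (m≤n+m (suc k) y)))
        (interlaceL-shift (suc k) ps (y ∷ ys))

lastRow : ∀ N → Tri N → List ℕ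
lastRow zero    tt      = []
lastRow (suc N) (t , r) = toList r

interlaceLast-toList : ∀ N (t : Tri N) r → interlaceLast N t r ≡ interlaceL (lastRow N t) (toList r)
interlaceLast-toList zero    tt      (x ∷ []) = refl
interlaceLast-toList (suc N) (t , p) r        = interlace-toList p r

validRows-step : ∀ n N (t : Tri N) r → validRows n (suc N) (t , r)
  ≡ validRows n N t ∧ inRangeL n (toList r) ∧ strictL (toList r) ∧ interlaceL (lastRow N t) (toList r)
validRows-step n N t r
  rewrite inRange-toList n r | strict-toList r | interlaceLast-toList N t r = refl

distinguished-last : ∀ N (t : Tri N) r → distinguished (suc N) (suc N) (t , r) ≡ isIdRowL 1 (toList r)
distinguished-last N t r rewrite T⇒true (≡⇒≡ᵇ N N refl) = isIdRow-toList 1 r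

distinguished-earlier : ∀ N i (t : Tri N) r → i ≢ suc N → distinguished (suc N) i (t , r) ≡ distinguished N i t
distinguished-earlier N i t r i≢N+1 rewrite ≢⇒≡ᵇ-false i≢N+1 = refl

distinguished-beyond : ∀ N i (t : Tri N) → N < i → distinguished N i t ≡ false
distinguished-beyond zero    i tt      _   = refl
distinguished-beyond (suc N) i (t , r) N<i =
  trans (distinguished-earlier N i t r (λ i≡ → <-irrefl (sym i≡) N<i))
        (distinguished-beyond N i t (<-trans (n<1+n N) N<i))

-- Interlacing bounds the previous row by the current one, so a bound on the
-- last row bounds every row: raising the range bound beyond it changes nothing.
interlaceL-bound : ∀ B ps rs → T (interlaceL ps rs) → All (_≤ B) rs → All (_≤ B) ps
interlaceL-bound B []       _            _  _ = []
interlaceL-bound B (p ∷ ps) (x ∷ y ∷ rs) il (_ ∷ y≤B ∷ rs≤B)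
  with ∧-elim (x ≤ᵇ p) il
... | _ , il′ with ∧-elim (p ≤ᵇ y) il′
...   | p≤y , il″ = ≤-trans (≤ᵇ⇒≤ p y p≤y) y≤B ∷ interlaceL-bound B ps (y ∷ rs) il″ (y≤B ∷ rs≤B)

inRangeL-bound : ∀ {B B′} xs → B ≤ B′ → All (_≤ B) xs → inRangeL B′ xs ≡ inRangeL B xs
inRangeL-bound []       _    _            = refl
inRangeL-bound (x ∷ xs) B≤B′ (x≤B ∷ xs≤B)
  rewrite T⇒true (≤⇒≤ᵇ x≤B) | T⇒true (≤⇒≤ᵇ (≤-trans x≤B B≤B′)) =
  cong ((1 ≤ᵇ x) ∧_) (inRangeL-bound xs B≤B′ xs≤B)

validRows-bound : ∀ {B B′} N (t : Tri N) → B ≤ B′ → All (_≤ B) (lastRow N t) →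
                  validRows B′ N t ≡ validRows B N t
validRows-bound zero    tt      _    _    = refl
validRows-bound {B} {B′} (suc N) (t , r) B≤B′ r≤B = begin
  validRows B′ (suc N) (t , r)                ≡⟨ validRows-step B′ N t r ⟩
  validRows B′ N t ∧ inRangeL B′ xs ∧ S ∧ L   ≡⟨ cong (λ b → validRows B′ N t ∧ b ∧ S ∧ L)
                                                      (inRangeL-bound xs B≤B′ r≤B) ⟩
  validRows B′ N t ∧ inRangeL B xs ∧ S ∧ L    ≡⟨ ∧-cong-under (inRangeL B xs ∧ S ∧ L) earlierRows ⟩
  validRows B N t ∧ inRangeL B xs ∧ S ∧ L     ≡⟨ validRows-step B N t r ⟨
  validRows B (suc N) (t , r)                 ∎
  where
  open ≡-Reasoning
  xs = toList r
  S  = strictL xs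
  L  = interlaceL (lastRow N t) xs
  earlierRows : T (inRangeL B xs ∧ S ∧ L) → validRows B′ N t ≡ validRows B N t
  earlierRows t′ = validRows-bound N t B≤B′ (interlaceL-bound B (lastRow N t) xs il r≤B)
    where il = proj₂ (∧-elim S (proj₂ (∧-elim (inRangeL B xs) t′)))

-- In a monotone triangle of size n ≥ 1 the last row is forced to be 1,…,n:
-- n strictly increasing numbers from [1, n].
monotone-last-distinguished : ∀ n (τ : Tri n) → 1 ≤ n → T (IsMT n τ) → T (distinguished n n τ)
monotone-last-distinguished (suc N) (t , r) _ valid
  rewrite distinguished-last N t r | validRows-step (suc N) N t r
  with ∧-elim (validRows (suc N) N t) valid
... | _ , rowOK with ∧-elim (inRangeL (suc N) (toList r)) rowOK
...   | inR , rest =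
  strict-bounded⇒run 1 (toList r) (proj₁ (∧-elim (strictL (toList r)) rest)) (All.map proj₁ entries)
    (subst (λ l → All (_< suc l) (toList r)) (sym (VP.length-toList r)) (All.map (s≤s ∘ proj₂) entries))
  where entries = inRangeL⇒All (suc N) (toList r) inR

glueRow : ∀ s {k} → Vec ℕ k → Vec ℕ (k + s)
glueRow s {k} r = V.cast (+-comm s k) (run 1 s V.++ V.map (_+ s) r)

unglueRow : ∀ s {k} → Vec ℕ (k + s) → Vec ℕ k
unglueRow s {k} r = V.map (_∸ s) (V.drop s (V.cast (+-comm k s) r))

glue : ∀ s m → Tri s → Tri m → Tri (m + s)
glue s zero    a tt      = a
glue s (suc m) a (b , r) = glue s m a b , glueRow s r

unglue : ∀ s m → Tri (m + s) → Tri s × Tri m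
unglue s zero    τ       = τ , tt
unglue s (suc m) (τ , r) = proj₁ (unglue s m τ) , (proj₂ (unglue s m τ) , unglueRow s r)

toList-glueRow : ∀ s {k} (r : Vec ℕ k) → toList (glueRow s r) ≡ glueL s (toList r)
toList-glueRow s r =
  trans (VP.toList-cast _ _)
        (trans (VP.toList-++ (run 1 s) _) (cong (runL 1 s ++_) (VP.toList-map (_+ s) r)))

toList-drop : ∀ s {k} (v : Vec ℕ (s + k)) → toList (V.drop s v) ≡ L.drop s (toList v)
toList-drop zero    v       = refl
toList-drop (suc s) (x ∷ v) = toList-drop s v

toList-unglueRow : ∀ s {k} (r : Vec ℕ (k + s)) → toList (unglueRow s r) ≡ unglueL s (toList r)
toList-unglueRow s r =
  trans (VP.toList-map (_∸ s) _)
        (cong (L.map (_∸ s)) (trans (toList-drop s _) (cong (L.drop s) (VP.toList-cast _ r))))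

toList-injective : ∀ {k} (v w : Vec ℕ k) → toList v ≡ toList w → v ≡ w
toList-injective v w eq = trans (sym (VP.cast-is-id refl v)) (VP.toList-injective refl v w eq)

unglueRow-glueRow : ∀ s {k} (r : Vec ℕ k) → unglueRow s (glueRow s r) ≡ r
unglueRow-glueRow s r = toList-injective _ r (begin
  toList (unglueRow s (glueRow s r))  ≡⟨ toList-unglueRow s (glueRow s r) ⟩
  unglueL s (toList (glueRow s r))    ≡⟨ cong (unglueL s) (toList-glueRow s r) ⟩
  unglueL s (glueL s (toList r))      ≡⟨ unglueL-glueL s (toList r) ⟩
  toList r                            ∎)
  where open ≡-Reasoning

glueRow-unglueRow : ∀ s {k} (r : Vec ℕ (k + s)) r′ → toList r ≡ runL 1 s ++ r′ → All (s ≤_) r′ →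
                    glueRow s (unglueRow s r) ≡ r
glueRow-unglueRow s r r′ r≡ r′≥s = toList-injective _ r (begin
  toList (glueRow s (unglueRow s r))    ≡⟨ toList-glueRow s (unglueRow s r) ⟩
  glueL s (toList (unglueRow s r))      ≡⟨ cong (glueL s) (toList-unglueRow s r) ⟩
  glueL s (unglueL s (toList r))        ≡⟨ cong (glueL s ∘ unglueL s) r≡ ⟩
  glueL s (unglueL s (runL 1 s ++ r′))  ≡⟨ glueL-unglueL s r′ r′≥s ⟩
  runL 1 s ++ r′                        ≡⟨ r≡ ⟨
  toList r                              ∎)
  where open ≡-Reasoning

unglue-glue : ∀ s m (a : Tri s) (b : Tri m) → unglue s m (glue s m a b) ≡ (a , b)
unglue-glue s zero    a tt      = refl
unglue-glue s (suc m) a (b , r) rewrite unglue-glue s m a b | unglueRow-glueRow s r = refl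

lastRow-glue : ∀ s m (a : Tri s) (b : Tri m) → lastRow s a ≡ runL 1 s →
               lastRow (m + s) (glue s m a b) ≡ glueL s (lastRow m b)
lastRow-glue s zero    a tt      a-last = trans a-last (sym (LP.++-identityʳ (runL 1 s)))
lastRow-glue s (suc m) a (b , r) _      = toList-glueRow s r

validRows-glue : ∀ k R m (a : Tri (suc k)) (b : Tri m) → lastRow (suc k) a ≡ runL 1 (suc k) →
  validRows (R + suc k) (m + suc k) (glue (suc k) m a b)
    ≡ validRows (R + suc k) (suc k) a ∧ validRows R m b
validRows-glue k R zero    a tt               _      = sym (∧-identityʳ _)
validRows-glue k R (suc m) a (b , r@(y ∷ ys)) a-last = begin
  validRows B (suc m + s) (g , glueRow s r)
    ≡⟨ validRows-step B (m + s) g (glueRow s r) ⟩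
  VJ ∧ inRangeL B row ∧ strictL row ∧ interlaceL (lastRow (m + s) g) row
    ≡⟨ cong₂ (λ G P → VJ ∧ inRangeL B G ∧ strictL G ∧ interlaceL P G)
             (toList-glueRow s r) (lastRow-glue s m a b a-last) ⟩
  VJ ∧ inRangeL B G ∧ strictL G ∧ interlaceL (glueL s (lastRow m b)) G
    ≡⟨ cong₂ (λ V L → V ∧ inRangeL B G ∧ strictL G ∧ L) (validRows-glue k R m a b a-last)
             (interlaceL-glue k (lastRow m b) y (toList ys)) ⟩
  (VA ∧ VB) ∧ inRangeL B G ∧ strictL G ∧ Li
    ≡⟨ ∧-regroup VA VB (inRangeL B G) (strictL G) (inRangeL R (toList r)) (strictL (toList r)) Li
                 (inRange-strict-glue k R y (toList ys)) ⟩
  VA ∧ VB ∧ inRangeL R (toList r) ∧ strictL (toList r) ∧ Li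
    ≡⟨ cong (VA ∧_) (validRows-step R m b r) ⟨
  VA ∧ validRows R (suc m) (b , r)
    ∎
  where
  open ≡-Reasoning
  s  = suc k
  B  = R + s
  g  = glue s m a b
  row = toList (glueRow s r)
  G  = glueL s (toList r)
  VJ = validRows B (m + s) g
  VA = validRows B s a
  VB = validRows R m b
  Li = interlaceL (lastRow m b) (toList r)

seam≢ : ∀ s m → s ≢ suc (m + s)
seam≢ s m s≡ = <-irrefl s≡ (s≤s (m≤n+m s m))

distinguished-glue-seam : ∀ s m (a : Tri s) (b : Tri m) →
                          distinguished (m + s) s (glue s m a b) ≡ distinguished s s a
distinguished-glue-seam s zero    a tt      = refl
distinguished-glue-seam s (suc m) a (b , r) =
  trans (distinguished-earlier (m + s) s (glue s m a b) (glueRow s r) (seam≢ s m))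
        (distinguished-glue-seam s m a b)

isIdRow-glueRow : ∀ s {k} (r : Vec ℕ k) → isIdRow 1 (glueRow s r) ≡ isIdRow 1 r
isIdRow-glueRow s r = begin
  isIdRow 1 (glueRow s r)                ≡⟨ isIdRow-toList 1 (glueRow s r) ⟩
  isIdRowL 1 (toList (glueRow s r))      ≡⟨ cong (isIdRowL 1) (toList-glueRow s r) ⟩
  isIdRowL 1 (glueL s (toList r))        ≡⟨ isIdRowL-run++ 1 s _ ⟩
  isIdRowL (s + 1) (L.map (_+ s) xs)     ≡⟨ cong (λ c → isIdRowL c (L.map (_+ s) xs)) (+-comm s 1) ⟩
  isIdRowL (1 + s) (L.map (_+ s) xs)     ≡⟨ isIdRowL-shift s 1 xs ⟩
  isIdRowL 1 xs                          ≡⟨ isIdRow-toList 1 r ⟨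
  isIdRow 1 r                            ∎
  where
  open ≡-Reasoning
  xs = toList r

distinguished-glue-below : ∀ s m j (a : Tri s) (b : Tri m) → 1 ≤ j →
                           distinguished (m + s) (j + s) (glue s m a b) ≡ distinguished m j b
distinguished-glue-below s zero    j a tt      1≤j = distinguished-beyond s (j + s) a (+-monoˡ-≤ s 1≤j)
distinguished-glue-below s (suc m) j a (b , r) 1≤j = begin
  (if j + s ≡ᵇ suc m + s then isIdRow 1 (glueRow s r) else distinguished (m + s) (j + s) (glue s m a b))
    ≡⟨ cong (λ c → if c then isIdRow 1 (glueRow s r) else distinguished (m + s) (j + s) (glue s m a b))
            (≡ᵇ-+ʳ s j (suc m)) ⟩
  (if j ≡ᵇ suc m then isIdRow 1 (glueRow s r) else distinguished (m + s) (j + s) (glue s m a b))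
    ≡⟨ cong₂ (λ u v → if j ≡ᵇ suc m then u else v)
             (isIdRow-glueRow s r) (distinguished-glue-below s m j a b 1≤j) ⟩
  (if j ≡ᵇ suc m then isIdRow 1 r else distinguished m j b)
    ∎
  where open ≡-Reasoning

lastRow-distinguished : ∀ N (t : Tri N) → T (distinguished N N t) → lastRow N t ≡ runL 1 N
lastRow-distinguished (suc N) (t , r) d rewrite distinguished-last N t r =
  trans (isIdRowL⇒run 1 (toList r) d) (cong (runL 1) (VP.length-toList r))

rows-below-seam : ∀ n s m (τ : Tri (m + s)) → T (validRows n (m + s) τ) → T (distinguished (m + s) s τ) →
                  ∃ λ r′ → lastRow (m + s) τ ≡ runL 1 s ++ r′ × All (s <_) r′
rows-below-seam n s zero    τ       _     d =
  [] , trans (lastRow-distinguished s τ d) (sym (LP.++-identityʳ (runL 1 s))) , []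
rows-below-seam n s (suc m) (t , r) valid d
  rewrite validRows-step n (m + s) t r | distinguished-earlier (m + s) s t r (seam≢ s m)
  with ∧-elim (validRows n (m + s) t) valid
... | t-valid , rowOK with ∧-elim (inRangeL n (toList r)) rowOK
...   | inR , rest with ∧-elim (strictL (toList r)) rest | rows-below-seam n s m t t-valid d
...     | st , il | r₀ , t-last , _ =
  interlaceL-keeps-run 1 s r₀ (toList r) (subst (λ p → T (interlaceL p (toList r))) t-last il) st
                       (All.map proj₁ (inRangeL⇒All n (toList r) inR))

glue-unglue : ∀ n s m (τ : Tri (m + s)) → T (validRows n (m + s) τ) → T (distinguished (m + s) s τ) →
              glue s m (proj₁ (unglue s m τ)) (proj₂ (unglue s m τ)) ≡ τ
glue-unglue n s zero    τ       _     _ = refl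
glue-unglue n s (suc m) (t , r) valid d with rows-below-seam n s (suc m) (t , r) valid d
... | r′ , r≡ , r′>s =
  cong₂ _,_ (glue-unglue n s m t (proj₁ (∧-elim (validRows n (m + s) t) valid))
                          (subst T (distinguished-earlier (m + s) s t r (seam≢ s m)) d))
            (glueRow-unglueRow s r r′ r≡ (All.map <⇒≤ r′>s))

-- Elements of EtaSet are determined by their triangle, all tests being
-- proof-irrelevant.
EtaSet-≡ : ∀ {n I} (x y : EtaSet n I) → proj₁ (proj₁ x) ≡ proj₁ (proj₁ y) → x ≡ y
EtaSet-≡ ((τ , v) , d) ((.τ , v′) , d′) refl =
  cong₂ (λ p q → (τ , p) , q) (T-irrelevant v v′) (All.irrelevant T-irrelevant d d′)

-- For n ≥ 1 the requirement that row n be distinguished is automatic.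
EtaSet-[]↔MT : ∀ n → 1 ≤ n → EtaSet n [] ↔ MT n
EtaSet-[]↔MT n 1≤n =
  mk↔ₛ′ proj₁ (λ τ → τ , monotone-last-distinguished n (proj₁ τ) 1≤n (proj₂ τ) ∷ [])
        (λ _ → refl) (λ x → EtaSet-≡ _ x refl)

module Gluing (k m : ℕ) (1≤m : 1 ≤ m) (J : List ℕ) (1≤J : All (1 ≤_) J) where

  s : ℕ
  s = suc k

  Glued : Tri (m + s) → Set
  Glued τ = T (IsMT (m + s) τ) ×
            All (λ i → T (distinguished (m + s) i τ)) (m + s ∷ s ∷ L.map (_+ s) J)

  -- once a ends with 1,…,s its entries are at most s, so the bound m + s
  -- imposed inside the glued triangle is the bound s of 𝔐_s
  IsMT-glue : ∀ a b → T (distinguished s s a) → IsMT (m + s) (glue s m a b) ≡ IsMT s a ∧ IsMT m b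
  IsMT-glue a b d = trans (validRows-glue k m m a b a-last) (cong (_∧ IsMT m b) bound-s)
    where
    a-last = lastRow-distinguished s a d
    bound-s : validRows (m + s) s a ≡ IsMT s a
    bound-s = validRows-bound s a (m≤n+m s m)
                (subst (All (_≤ s)) (sym a-last) (All.map (λ (_ , hi) → ≤-pred hi) (runL-bounds 1 s)))

  below⇒ : ∀ a b → All (λ i → T (distinguished (m + s) i (glue s m a b))) (L.map (_+ s) J) →
           All (λ j → T (distinguished m j b)) J
  below⇒ a b d =
    All.zipWith (λ (1≤j , dj) → subst T (distinguished-glue-below s m _ a b 1≤j) dj) (1≤J , AllP.map⁻ d)

  below⇐ : ∀ a b → All (λ j → T (distinguished m j b)) J →
           All (λ i → T (distinguished (m + s) i (glue s m a b))) (L.map (_+ s) J)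
  below⇐ a b d = AllP.map⁺
    (All.zipWith (λ (1≤j , dj) → subst T (sym (distinguished-glue-below s m _ a b 1≤j)) dj) (1≤J , d))

  pieces : ∀ a b → Glued (glue s m a b) → EtaSet s [] × EtaSet m J
  pieces a b (v , d) = ((a , proj₁ ab-valid) , a-dist ∷ []) ,
                       ((b , proj₂ ab-valid) , b-dist ∷ below⇒ a b (All.tail (All.tail d)))
    where
    a-dist = subst T (distinguished-glue-seam s m a b) (All.head (All.tail d))
    b-dist = subst T (distinguished-glue-below s m m a b 1≤m) (All.head d)
    ab-valid = ∧-elim (IsMT s a) (subst T (IsMT-glue a b a-dist) v)

  to : EtaSet (m + s) (s ∷ L.map (_+ s) J) → EtaSet s [] × EtaSet m J
  to ((τ , v) , d) = pieces (proj₁ (unglue s m τ)) (proj₂ (unglue s m τ)) (subst Glued (sym τ-glued) (v , d))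
    where τ-glued = glue-unglue (m + s) s m τ v (All.head (All.tail d))

  from : EtaSet s [] × EtaSet m J → EtaSet (m + s) (s ∷ L.map (_+ s) J)
  from (((a , va) , da ∷ []) , ((b , vb) , db ∷ dJ)) =
    (glue s m a b , subst T (sym (IsMT-glue a b da)) (∧-intro va vb)) ,
    subst T (sym (distinguished-glue-below s m m a b 1≤m)) db ∷
    subst T (sym (distinguished-glue-seam s m a b)) da ∷ below⇐ a b dJ

  glue↔ : EtaSet (m + s) (s ∷ L.map (_+ s) J) ↔ (EtaSet s [] × EtaSet m J)
  glue↔ = mk↔ₛ′ to from to∘from from∘to
    where
    to∘from : ∀ y → to (from y) ≡ y
    to∘from (x@((a , _) , _ ∷ []) , y@((b , _) , _ ∷ _)) =
      cong₂ _,_ (EtaSet-≡ _ x (cong proj₁ (unglue-glue s m a b)))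
                (EtaSet-≡ _ y (cong proj₂ (unglue-glue s m a b)))
    from∘to : ∀ x → from (to x) ≡ x
    from∘to x@((τ , v) , d) = EtaSet-≡ _ x (glue-unglue (m + s) s m τ v (All.head (All.tail d)))

glue↔ : ∀ s m → 1 ≤ s → 1 ≤ m → (J : List ℕ) → All (1 ≤_) J →
        EtaSet (m + s) (s ∷ L.map (_+ s) J) ↔ (EtaSet s [] × EtaSet m J)
glue↔ (suc k) m _ 1≤m J 1≤J = Gluing.glue↔ k m 1≤m J 1≤J

∸-split : ∀ {p i j} → p ≤ i → i ≤ j → j ∸ p ≡ (j ∸ i) + (i ∸ p)
∸-split {p} {i} {j} p≤i i≤j = begin
  j ∸ p             ≡⟨ cong (_∸ p) (m∸n+n≡m i≤j) ⟨
  (j ∸ i) + i ∸ p   ≡⟨ +-∸-assoc (j ∸ i) p≤i ⟩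
  (j ∸ i) + (i ∸ p) ∎
  where open ≡-Reasoning

∸-split-all : ∀ {p i} I → p ≤ i → All (i <_) I → L.map (_∸ p) I ≡ L.map (_+ (i ∸ p)) (L.map (_∸ i) I)
∸-split-all []      _   []          = refl
∸-split-all (j ∷ I) p≤i (i<j ∷ i<I) = cong₂ _∷_ (∸-split p≤i (<⇒≤ i<j)) (∸-split-all I p≤i i<I)

-- Counting by induction on the distinguished rows, all measured from the
-- previous distinguished row p: cut at the first one, i, and recurse below.
module Counting (A : ℕ → ℕ) (MT↔A : ∀ m → MT m ↔ Fin (A m)) where

  gaps↔ : ∀ p n I → p < n → AllPairs _<_ I → All (p <_) I → All (_< n) I →
          EtaSet (n ∸ p) (L.map (_∸ p) I) ↔ Fin (gapProduct A p I n)
  gaps↔ p n []      p<n _ _ _ = ↔-trans (EtaSet-[]↔MT (n ∸ p) (m<n⇒0<n∸m p<n)) (MT↔A (n ∸ p))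
  gaps↔ p n (i ∷ I) p<n (i<I ∷ increasing) (p<i ∷ _) (i<n ∷ I<n) =
    subst₂ (λ N K → EtaSet N ((i ∸ p) ∷ K) ↔ Fin (A (i ∸ p) * gapProduct A i I n))
           (sym (∸-split (<⇒≤ p<i) (<⇒≤ i<n))) (sym (∸-split-all I (<⇒≤ p<i) i<I))
      (↔-trans (glue↔ (i ∸ p) (n ∸ i) (m<n⇒0<n∸m p<i) (m<n⇒0<n∸m i<n) (L.map (_∸ i) I)
                      (AllP.map⁺ (All.map m<n⇒0<n∸m i<I)))
      (↔-trans (↔-trans (EtaSet-[]↔MT (i ∸ p) (m<n⇒0<n∸m p<i)) (MT↔A (i ∸ p))
                ×-↔ gaps↔ i n I i<n increasing i<I I<n)
               (↔-sym *↔×)))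

lemma3 : (A : ℕ → ℕ) → (∀ m → MT m ↔ Fin (A m))
    → (n : ℕ) → 1 ≤ n
    → (I : List ℕ) → Linked _<_ I → All (λ i → 1 ≤ i) I → All (λ i → i < n) I
    → EtaSet n I ↔ Fin (gapProduct A 0 I n)
lemma3 A MT↔A n 1≤n I increasing 1≤I I<n =
  subst (λ K → EtaSet n K ↔ Fin (gapProduct A 0 I n)) (LP.map-id I)
        (Counting.gaps↔ A MT↔A 0 n I 1≤n (Linked⇒AllPairs <-trans increasing) 1≤I I<n)
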